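{- Let $P$ be a positive event pattern (built from event types using only the Kleene plus operator $P_i+$ and the event sequence operator $\textsf{SEQ}(P_i,P_j)$). Let $trends(P)$ be the set of event sequences matched by $P$ over any input event stream. Then for all $tr_1, tr_2 \in trends(P)$, the first events of $tr_1$ and $tr_2$ have the same event type, and the last events of $tr_1$ and $tr_2$ have the same event type.
   Context: Events: each event $e$ has an event type $e.type$ and an occurrence time $e.time \in \mathbb{Q}_{\ge 0}$. An event sequence is a finite sequence of events. Positive patterns are defined recursively, together with the sets $matches(\cdot)$ of event sequences they match: (i) An event type $E$ is a pattern; it matches exactly the one-event sequences $(e)$ with $e.type = E$. (ii) If $P_i,P_j$ are patterns, $\textsf{SEQ}(P_i,P_j)$ is a pattern; it matches an event sequence $s=(e_1,\dots,e_k)$ if there is $m\in\mathbb{N}$ with $1\le m\le k$ such that $(e_1,\dots,e_m)\in matches(P_i)$, $(e_{m+1},\dots,e_k)\in matches(P_j)$, and $e_l.time<e_{l+1}.time$ for all $1\le l<k$. (iii) If $P_i$ is a pattern, $P_i+$ is a pattern; it matches an event sequence $tr$ that is the concatenation $s_1 s_2\cdots s_k$ ($k\ge 1$) of event sequences with $s_l\in matches(P_i)$ for all $1\le l\le k$ and (last event of $s_l$).time $<$ (first event of $s_{l+1}$).time for all $1\le l<k$. For an event sequence matched by a pattern, its "first event" and "last event" are its first and last entries. -}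

module Defs where

open import Data.List using (List; []; _∷_; _++_)
open import Data.Product using (Σ; _×_; _,_; ∃-syntax)
open import Data.Rational using (ℚ; 0ℚ; _≤_; _<_)
open import Relation.Binary.PropositionalEquality using (_≡_)

record Event (T : Set) : Set where
  constructor mkEvent
  field
    type    : T
    time    : ℚ
    time≥0  : 0ℚ ≤ time
open Event public

EventSeq : Set → Set
EventSeq T = List (Event T)

data Pattern (T : Set) : Set where
  ev   : T → Pattern T
  SEQ  : Pattern T → Pattern T → Pattern T
  _+   : Pattern T → Pattern T

module _ {T : Set} where

  data Increasing : EventSeq T → Set where
    inc[]  : Increasing []
    inc[x] : ∀ {e} → Increasing (e ∷ [])
    inc∷   : ∀ {e₁ e₂ s} → time e₁ < time e₂ → Increasing (e₂ ∷ s) → Increasing (e₁ ∷ e₂ ∷ s)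

  data FirstEvent : EventSeq T → Event T → Set where
    first : ∀ {e s} → FirstEvent (e ∷ s) e

  data LastEvent : EventSeq T → Event T → Set where
    last[x] : ∀ {e} → LastEvent (e ∷ []) e
    last∷   : ∀ {e e' s} → LastEvent s e' → LastEvent (e ∷ s) e'

  data Matches : Pattern T → EventSeq T → Set where
    m-ev   : ∀ {E} (e : Event T) → type e ≡ E → Matches (ev E) (e ∷ [])
    m-seq  : ∀ {Pi Pj} (s₁ s₂ : EventSeq T) →
             Matches Pi s₁ → Matches Pj s₂ →
             Increasing (s₁ ++ s₂) → Matches (SEQ Pi Pj) (s₁ ++ s₂)
    -- Kleene plus: k = 1
    m-plus1 : ∀ {Pi} (s : EventSeq T) → Matches Pi s → Matches (Pi +) s
    -- Kleene plus: s₁ followed by a concatenation s₂ ⋯ s_k (k ≥ 2)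
    m-plus∷ : ∀ {Pi} (s₁ rest : EventSeq T) (l f : Event T) →
              Matches Pi s₁ → Matches (Pi +) rest →
              LastEvent s₁ l → FirstEvent rest f → time l < time f →
              Matches (Pi +) (s₁ ++ rest)

  trends : Pattern T → EventSeq T → Set
  trends P tr = Matches P tr

module Submission where

open import Defs
open import Relation.Binary.PropositionalEquality using (_≡_; sym; trans)
open import Data.Product using (_×_; _,_)
open import Data.List using ([]; _∷_; _++_)

-- Every match of P starts with an event of type firstType P and ends with one of
-- type lastType P, read off the syntax of P: SEQ takes the first type of its left
-- and the last type of its right operand, and P + inherits both from P.
-- Matches are never empty, so the first event of s₁ ++ s₂ lies in s₁ and the last in s₂.

module _ {T : Set} where

  firstType : Pattern T → T
  firstType (ev E)    = E
  firstType (SEQ P Q) = firstType P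
  firstType (P +)     = firstType P

  lastType : Pattern T → T
  lastType (ev E)    = E
  lastType (SEQ P Q) = lastType Q
  lastType (P +)     = lastType P

  data NonEmpty : EventSeq T → Set where
    nonEmpty : ∀ {e s} → NonEmpty (e ∷ s)

  Matches⇒NonEmpty : ∀ {P s} → Matches P s → NonEmpty s
  Matches⇒NonEmpty (m-ev _ _) = nonEmpty
  Matches⇒NonEmpty (m-seq _ _ m _ _) with Matches⇒NonEmpty m
  ... | nonEmpty = nonEmpty
  Matches⇒NonEmpty (m-plus1 _ m) = Matches⇒NonEmpty m
  Matches⇒NonEmpty (m-plus∷ _ _ _ _ m _ _ _ _) with Matches⇒NonEmpty m
  ... | nonEmpty = nonEmpty

  FirstEvent-++ˡ : ∀ {s₁ s₂ f} → NonEmpty s₁ → FirstEvent (s₁ ++ s₂) f → FirstEvent s₁ f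
  FirstEvent-++ˡ nonEmpty first = first

  LastEvent-++ʳ : ∀ s₁ {s₂ l} → NonEmpty s₂ → LastEvent (s₁ ++ s₂) l → LastEvent s₂ l
  LastEvent-++ʳ []           _        p          = p
  LastEvent-++ʳ (_ ∷ [])     nonEmpty (last∷ p) = p
  LastEvent-++ʳ (_ ∷ e ∷ s₁) n        (last∷ p) = LastEvent-++ʳ (e ∷ s₁) n p

  Matches⇒first-type : ∀ {P s f} → Matches P s → FirstEvent s f → type f ≡ firstType P
  Matches⇒first-type (m-ev _ type≡E)              first = type≡E
  Matches⇒first-type (m-seq _ _ m _ _)            p = Matches⇒first-type m (FirstEvent-++ˡ (Matches⇒NonEmpty m) p)
  Matches⇒first-type (m-plus1 _ m)                p = Matches⇒first-type m p
  Matches⇒first-type (m-plus∷ _ _ _ _ m _ _ _ _)  p = Matches⇒first-type m (FirstEvent-++ˡ (Matches⇒NonEmpty m) p)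

  Matches⇒last-type : ∀ {P s l} → Matches P s → LastEvent s l → type l ≡ lastType P
  Matches⇒last-type (m-ev _ type≡E)               last[x] = type≡E
  Matches⇒last-type (m-ev _ _)                    (last∷ ())
  Matches⇒last-type (m-seq s₁ _ _ m _)            p = Matches⇒last-type m (LastEvent-++ʳ s₁ (Matches⇒NonEmpty m) p)
  Matches⇒last-type (m-plus1 _ m)                 p = Matches⇒last-type m p
  Matches⇒last-type (m-plus∷ s₁ _ _ _ _ m _ _ _)  p = Matches⇒last-type m (LastEvent-++ʳ s₁ (Matches⇒NonEmpty m) p)

theorem1 : {T : Set} (P : Pattern T) (tr₁ tr₂ : EventSeq T) →
    trends P tr₁ → trends P tr₂ →
    (∀ f₁ f₂ → FirstEvent tr₁ f₁ → FirstEvent tr₂ f₂ → type f₁ ≡ type f₂) ×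
    (∀ l₁ l₂ → LastEvent tr₁ l₁ → LastEvent tr₂ l₂ → type l₁ ≡ type l₂)
theorem1 P tr₁ tr₂ m₁ m₂ =
  (λ f₁ f₂ p q → trans (Matches⇒first-type m₁ p) (sym (Matches⇒first-type m₂ q))) ,
  (λ l₁ l₂ p q → trans (Matches⇒last-type m₁ p) (sym (Matches⇒last-type m₂ q)))
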